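{- Let $t$ be a pure $\lambda$-term. Then there exist a typing context $\Gamma$, a type $\tau$ and a derivation of $\Gamma \vdash t:\tau$ in system $\mathcal{V}$ if and only if $t$ is normalising for weak-head needed reduction $\rightarrow_{\mathtt{whnd}}$.
   Context: Pure $\lambda$-terms $t::= x\mid t\,u\mid \lambda x.t$ with $\beta$-reduction. Occurrences, redex occurrences, residuals: occurrences are words over $\{0,1\}$ ($0$ = function part / abstraction body, $1$ = argument); a redex $r$ is used in a reduction sequence if the sequence contracts $r$ or one of its residuals (standard residuals of the $\lambda$-calculus). A term is in weak-head normal form (WHNF) if it is $\lambda x.t$ or $x\,t_1\cdots t_n$ ($n\geq 0$). A redex of $t$ is weak-head needed if every reduction sequence from $t$ to a WHNF uses it; $\rightarrow_{\mathtt{whnd}}$ is $\beta$-reduction restricted to contracting weak-head needed redexes; $t$ is normalising for it if some $\rightarrow_{\mathtt{whnd}}$-sequence from $t$ reaches a term with no $\rightarrow_{\mathtt{whnd}}$-step. System $\mathcal{V}$: types $\tau,\sigma ::= \mathtt{a} \mid \alpha \mid \mathcal{M}\to\tau$ where $\mathtt{a}$ is a constant, $\alpha$ ranges over type variables, and multiset types $\mathcal{M}=[\tau_i]_{i\in I}$ are finite multisets of types ($[\,]$ the empty one). Typing contexts $\Gamma$ map variables to multiset types, all but finitely many to $[\,]$; $(\Gamma+\Delta)(x)=\Gamma(x)\sqcup\Delta(x)$ (multiset union); $\Gamma\setminus x$ sets $x$ to $[\,]$. Rules: (ax) $x:[\tau]\vdash x:\tau$; (val) $\emptyset\vdash \lambda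 x.t:\mathtt{a}$; ($\to$i) from $\Gamma\vdash t:\tau$ infer $\Gamma\setminus x\vdash \lambda x.t:\Gamma(x)\to\tau$; ($\to$e) from $\Gamma\vdash t:[\sigma_i]_{i\in I}\to\tau$ and $\Delta_i\vdash u:\sigma_i$ for each $i\in I$ ($I$ possibly empty) infer $\Gamma+\sum_{i\in I}\Delta_i\vdash t\,u:\tau$. -}

module Defs where

open import Data.Nat using (ℕ; zero; suc)
open import Data.Fin using (Fin; zero; suc)
open import Data.List using (List; []; _∷_; _++_)
open import Data.Vec using (Vec; []; _∷_; zipWith; replicate; _[_]≔_)
open import Data.Product using (Σ; _×_; _,_)
open import Data.Sum using (_⊎_)
open import Data.Unit using (⊤)
open import Data.Empty using (⊥)
open import Relation.Binary.PropositionalEquality using (_≡_; _≢_)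
open import Relation.Nullary using (¬_)

data Tm (n : ℕ) : Set where
  var : Fin n → Tm n
  app : Tm n → Tm n → Tm n
  lam : Tm (suc n) → Tm n

ext : ∀ {m k} → (Fin m → Fin k) → Fin (suc m) → Fin (suc k)
ext ρ zero    = zero
ext ρ (suc i) = suc (ρ i)

ren : ∀ {m k} → (Fin m → Fin k) → Tm m → Tm k
ren ρ (var i)   = var (ρ i)
ren ρ (app t u) = app (ren ρ t) (ren ρ u)
ren ρ (lam t)   = lam (ren (ext ρ) t)

exts : ∀ {m k} → (Fin m → Tm k) → Fin (suc m) → Tm (suc k)
exts σ zero    = var zero
exts σ (suc i) = ren suc (σ i)

sub : ∀ {m k} → (Fin m → Tm k) → Tm m → Tm k
sub σ (var i)   = σ i
sub σ (app t u) = app (sub σ t) (sub σ u)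
sub σ (lam t)   = lam (sub (exts σ) t)

sub0 : ∀ {n} → Tm n → Fin (suc n) → Tm n
sub0 u zero    = u
sub0 u (suc i) = var i

_[_] : ∀ {n} → Tm (suc n) → Tm n → Tm n
b [ u ] = sub (sub0 u) b

-- Occurrences: words over {0,1}; 0 = function part / abstraction body,
-- 1 = argument.

data Dir : Set where
  d0 d1 : Dir

Pos : Set
Pos = List Dir

IsRedex : ∀ {n} → Tm n → Pos → Set
IsRedex (app (lam b) u) []       = ⊤
IsRedex (app t u)       []       = ⊥
IsRedex (app t u)       (d0 ∷ p) = IsRedex t p
IsRedex (app t u)       (d1 ∷ p) = IsRedex u p
IsRedex (lam t)         (d0 ∷ p) = IsRedex t p
IsRedex _               _        = ⊥

IsVarOcc : ∀ {m} → Tm m → Fin m → Pos → Set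
IsVarOcc (var y)   x []       = y ≡ x
IsVarOcc (app t u) x (d0 ∷ v) = IsVarOcc t x v
IsVarOcc (app t u) x (d1 ∷ v) = IsVarOcc u x v
IsVarOcc (lam t)   x (d0 ∷ v) = IsVarOcc t (suc x) v
IsVarOcc _         _ _        = ⊥

data Step {n : ℕ} : Tm n → Pos → Tm n → Set where
  β    : ∀ {b u} → Step (app (lam b) u) [] (b [ u ])
  appL : ∀ {t t' u p} → Step t p t' → Step (app t u) (d0 ∷ p) (app t' u)
  appR : ∀ {t u u' p} → Step u p u' → Step (app t u) (d1 ∷ p) (app t u')
  lamS : ∀ {t t' p} → Step {suc n} t p t' → Step (lam t) (d0 ∷ p) (lam t')

-- Res t p q q' : q' is a residual (in the reduct) of the redex occurrence q
-- of t, after contracting the redex at occurrence p of t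
-- (standard residuals of the λ-calculus).
data Res : {n : ℕ} → Tm n → Pos → Pos → Pos → Set where
  root-body : ∀ {n b u w} → Res {n} (app (lam b) u) [] (d0 ∷ d0 ∷ w) w
  -- q inside the argument: one residual per occurrence v of the bound variable
  root-arg  : ∀ {n b u v w} → IsVarOcc b zero v →
              Res {n} (app (lam b) u) [] (d1 ∷ w) (v ++ w)
  above     : ∀ {n t d p} → Res {n} t (d ∷ p) [] []
  disj      : ∀ {n t d e p q} → d ≢ e → Res {n} t (d ∷ p) (e ∷ q) (e ∷ q)
  app-l     : ∀ {n t u p q q'} → Res {n} t p q q' →
              Res (app t u) (d0 ∷ p) (d0 ∷ q) (d0 ∷ q')
  app-r     : ∀ {n t u p q q'} → Res {n} u p q q' →
              Res (app t u) (d1 ∷ p) (d1 ∷ q) (d1 ∷ q')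
  lam-b     : ∀ {n t p q q'} → Res {suc n} t p q q' →
              Res {n} (lam t) (d0 ∷ p) (d0 ∷ q) (d0 ∷ q')

data _↠_ {n : ℕ} : Tm n → Tm n → Set where
  done : ∀ {t} → t ↠ t
  step : ∀ {t t' s} (p : Pos) → Step t p t' → t' ↠ s → t ↠ s

data Uses {n : ℕ} : {t s : Tm n} → t ↠ s → Pos → Set where
  here  : ∀ {t t' s p} {st : Step t p t'} {ρ : t' ↠ s} → Uses (step p st ρ) p
  there : ∀ {t t' s p r r'} {st : Step t p t'} {ρ : t' ↠ s} →
          Res t p r r' → Uses ρ r' → Uses (step p st ρ) r

data Neutral {n : ℕ} : Tm n → Set where
  nvar : ∀ {x} → Neutral (var x)
  napp : ∀ {t u} → Neutral t → Neutral (app t u)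

data WHNF {n : ℕ} : Tm n → Set where
  wlam : ∀ {t} → WHNF (lam t)
  wneu : ∀ {t} → Neutral t → WHNF t

WhNeeded : ∀ {n} → Tm n → Pos → Set
WhNeeded {n} t r =
  IsRedex t r × (∀ (s : Tm n) (ρ : t ↠ s) → WHNF s → Uses ρ r)

data _→whnd_ {n : ℕ} (t t' : Tm n) : Set where
  whnd : (p : Pos) → WhNeeded t p → Step t p t' → t →whnd t'

data _→whnd*_ {n : ℕ} : Tm n → Tm n → Set where
  refl* : ∀ {t} → t →whnd* t
  step* : ∀ {t t' s} → t →whnd t' → t' →whnd* s → t →whnd* s

WhndNormal : ∀ {n} → Tm n → Set
WhndNormal {n} t = ¬ (Σ (Tm n) λ t' → t →whnd t')

WhndNormalising : ∀ {n} → Tm n → Set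
WhndNormalising {n} t = Σ (Tm n) λ s → (t →whnd* s) × WhndNormal s

-- types; a multiset type is represented by a list, considered up to
-- permutation (see _≈M_)
data Ty : Set where
  a   : Ty
  tv  : ℕ → Ty
  _⇒_ : List Ty → Ty → Ty

MTy : Set
MTy = List Ty

-- equality of types as multisets (deep: permutation at every level)
mutual
  data _≈T_ : Ty → Ty → Set where
    a≈  : a ≈T a
    tv≈ : ∀ {i} → tv i ≈T tv i
    ⇒≈  : ∀ {M N τ σ} → M ≈M N → τ ≈T σ → (M ⇒ τ) ≈T (N ⇒ σ)

  data _≈M_ : MTy → MTy → Set where
    []≈ : [] ≈M []
    ∷≈  : ∀ {τ σ M N₁ N₂} → τ ≈T σ → M ≈M (N₁ ++ N₂) →
          (τ ∷ M) ≈M (N₁ ++ σ ∷ N₂)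

Ctx : ℕ → Set
Ctx n = Vec MTy n

∅ : ∀ {n} → Ctx n
∅ {n} = replicate n []

_+_ : ∀ {n} → Ctx n → Ctx n → Ctx n
_+_ = zipWith _++_

single : ∀ {n} → Fin n → Ty → Ctx n
single x τ = ∅ [ x ]≔ (τ ∷ [])

mutual
  data _⊢_∶_ : {n : ℕ} → Ctx n → Tm n → Ty → Set where
    ax   : ∀ {n} {x : Fin n} {τ} → single x τ ⊢ var x ∶ τ
    val  : ∀ {n} {t : Tm (suc n)} → ∅ ⊢ lam t ∶ a
    →i   : ∀ {n} {Γ : Ctx n} {M t τ} → (M ∷ Γ) ⊢ t ∶ τ → Γ ⊢ lam t ∶ (M ⇒ τ)
    →e   : ∀ {n} {Γ Δ : Ctx n} {t u M N τ} →
           Γ ⊢ t ∶ (M ⇒ τ) → Args Δ u N → M ≈M N → (Γ + Δ) ⊢ app t u ∶ τ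

  -- Args Δ u [σ_i]_i : derivations Δ_i ⊢ u : σ_i for each i, Δ = Σ Δ_i
  data Args : {n : ℕ} → Ctx n → Tm n → MTy → Set where
    nil  : ∀ {n} {u : Tm n} → Args ∅ u []
    cons : ∀ {n} {Δ Δs : Ctx n} {u σ N} →
           Δ ⊢ u ∶ σ → Args Δs u N → Args (Δ + Δs) u (σ ∷ N)

-- In a derivation of system V the weak-head redex (λx.b) u of a term, if there is one, is typed by
-- (→e) over (→i): rule (val) gives abstractions the type a, which is not an arrow. Contracting it
-- replaces the axioms for x by the derivations of u, so the number of (→e) rules strictly decreases.
-- The weak-head redex is used by every reduction to a WHNF, hence weak-head needed, and the terms
-- without →whnd-step are exactly the WHNFs; so weak-head reduction of a typable term is a
-- →whnd-sequence that terminates. Conversely WHNFs are typable (λx.t by (val), x t₁ ⋯ tₙ by giving x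
-- the type [] → ⋯ → [] → a), and typability is reflected by every β-step: an argument is typed once
-- per occurrence of the bound variable, and not at all when it is erased.

module Submission where

open import Defs
open import Level using (0ℓ)
open import Algebra.Bundles using (CommutativeMonoid)
import Algebra.Properties.CommutativeSemigroup
open import Data.Empty using (⊥-elim)
open import Data.Fin using (Fin; zero; suc)
open import Data.List using (List; []; _∷_; _++_)
open import Data.List.Properties using (++-assoc; ++-identityʳ; ∷-injective; ++-conicalˡ; ++-conicalʳ)
open import Data.Nat as ℕ using (ℕ; zero; suc; _≤_; _<_; z≤n; s≤s)
open import Data.Nat.Induction using (<-wellFounded)
import Data.Nat.Properties as ℕP
open import Data.Nat.Properties using (≤-trans; m≤m+n)
open import Data.Product using (Σ; ∃; ∃₂; _×_; _,_; proj₂)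
open import Data.Sum using (_⊎_; inj₁; inj₂)
open import Data.Unit using (tt)
open import Data.Vec using ([]; _∷_; _[_]≔_)
import Data.Vec.Properties as Vecₚ
open import Data.Vec.Relation.Binary.Pointwise.Inductive as Pointwise using (Pointwise; []; _∷_)
open import Function using (id; _∘_)
open import Function.Bundles using (_⇔_; mk⇔)
open import Induction.WellFounded using (Acc; acc)
open import Relation.Binary.PropositionalEquality using (_≡_; refl; sym; trans; cong; cong₂; subst)
import Relation.Binary.Reasoning.Setoid
open import Relation.Nullary using (¬_)

module ℕ-CS = Algebra.Properties.CommutativeSemigroup ℕP.+-commutativeSemigroup

-- Multisets of types

split-++≡++-∷ : ∀ {A : Set} (xs ys us vs : List A) {z} → xs ++ ys ≡ us ++ z ∷ vs →
  (∃ λ ws → xs ≡ us ++ z ∷ ws × vs ≡ ws ++ ys) ⊎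
  (∃ λ ws → ys ≡ ws ++ z ∷ vs × us ≡ xs ++ ws)
split-++≡++-∷ []       ys us       vs eq   = inj₂ (us , eq , refl)
split-++≡++-∷ (x ∷ xs) ys []       vs refl = inj₁ (xs , refl , refl)
split-++≡++-∷ (x ∷ xs) ys (u ∷ us) vs eq with ∷-injective eq
... | refl , eq′ with split-++≡++-∷ xs ys us vs eq′
... | inj₁ (ws , p , q) = inj₁ (ws , cong (x ∷_) p , q)
... | inj₂ (ws , p , q) = inj₂ (ws , p , cong (x ∷_) q)

∷-cong-≈M : ∀ {τ σ M N} → τ ≈T σ → M ≈M N → (τ ∷ M) ≈M (σ ∷ N)
∷-cong-≈M = ∷≈ {N₁ = []}

mutual
  ≈T-refl : ∀ {τ} → τ ≈T τ
  ≈T-refl {a}     = a≈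
  ≈T-refl {tv i}  = tv≈
  ≈T-refl {M ⇒ τ} = ⇒≈ ≈M-refl ≈T-refl

  ≈M-refl : ∀ {M} → M ≈M M
  ≈M-refl {[]}    = []≈
  ≈M-refl {τ ∷ M} = ∷-cong-≈M ≈T-refl ≈M-refl

≡⇒≈M : ∀ {M N} → M ≡ N → M ≈M N
≡⇒≈M refl = ≈M-refl

≈M-delete : ∀ M₁ M₂ {σ N} → (M₁ ++ σ ∷ M₂) ≈M N →
  ∃₂ λ N₁ N₂ → ∃ λ ρ → N ≡ N₁ ++ ρ ∷ N₂ × σ ≈T ρ × (M₁ ++ M₂) ≈M (N₁ ++ N₂)
≈M-delete []       M₂ (∷≈ {N₁ = N₁} {N₂} σ≈ρ M≈N) = N₁ , N₂ , _ , refl , σ≈ρ , M≈N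
≈M-delete (τ ∷ M₁) M₂ (∷≈ {σ = τ′} {N₁ = N₁} {N₂} τ≈τ′ M≈N)
  with ≈M-delete M₁ M₂ M≈N
... | P₁ , P₂ , ρ , eq , σ≈ρ , M≈P with split-++≡++-∷ N₁ N₂ P₁ P₂ eq
... | inj₁ (ws , refl , refl) =
  P₁ , ws ++ τ′ ∷ N₂ , ρ , ++-assoc P₁ (ρ ∷ ws) (τ′ ∷ N₂) , σ≈ρ ,
  subst (_ ≈M_) (++-assoc P₁ ws (τ′ ∷ N₂))
    (∷≈ τ≈τ′ (subst (_ ≈M_) (sym (++-assoc P₁ ws N₂)) M≈P))
... | inj₂ (ws , refl , refl) =
  N₁ ++ τ′ ∷ ws , P₂ , ρ , sym (++-assoc N₁ (τ′ ∷ ws) (ρ ∷ P₂)) , σ≈ρ ,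
  subst (_ ≈M_) (sym (++-assoc N₁ (τ′ ∷ ws) P₂))
    (∷≈ τ≈τ′ (subst (_ ≈M_) (++-assoc N₁ ws P₂) M≈P))

mutual
  ≈T-trans : ∀ {τ σ ρ} → τ ≈T σ → σ ≈T ρ → τ ≈T ρ
  ≈T-trans a≈           q            = q
  ≈T-trans tv≈          q            = q
  ≈T-trans (⇒≈ M≈N τ≈σ) (⇒≈ N≈P σ≈ρ) = ⇒≈ (≈M-trans M≈N N≈P) (≈T-trans τ≈σ σ≈ρ)

  ≈M-trans : ∀ {M N P} → M ≈M N → N ≈M P → M ≈M P
  ≈M-trans []≈                          q = q
  ≈M-trans (∷≈ {N₁ = N₁} {N₂} τ≈σ M≈N) q with ≈M-delete N₁ N₂ q
  ... | P₁ , P₂ , ρ , refl , σ≈ρ , N≈P = ∷≈ (≈T-trans τ≈σ σ≈ρ) (≈M-trans M≈N N≈P)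

mutual
  ≈T-sym : ∀ {τ σ} → τ ≈T σ → σ ≈T τ
  ≈T-sym a≈           = a≈
  ≈T-sym tv≈          = tv≈
  ≈T-sym (⇒≈ M≈N τ≈σ) = ⇒≈ (≈M-sym M≈N) (≈T-sym τ≈σ)

  ≈M-sym : ∀ {M N} → M ≈M N → N ≈M M
  ≈M-sym []≈                     = []≈
  ≈M-sym (∷≈ {N₁ = N₁} τ≈σ M≈N) =
    ≈M-trans (++∷-≈M-∷++ N₁) (∷-cong-≈M (≈T-sym τ≈σ) (≈M-sym M≈N))
    where
    ++∷-≈M-∷++ : ∀ N₁ {σ N₂} → (N₁ ++ σ ∷ N₂) ≈M (σ ∷ N₁ ++ N₂)
    ++∷-≈M-∷++ []       = ≈M-refl
    ++∷-≈M-∷++ (τ ∷ N₁) = ∷≈ {N₁ = _ ∷ []} ≈T-refl (++∷-≈M-∷++ N₁)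

++-cong-≈M : ∀ {M M′ N N′} → M ≈M M′ → N ≈M N′ → (M ++ N) ≈M (M′ ++ N′)
++-cong-≈M []≈ N≈N′ = N≈N′
++-cong-≈M {N′ = N′} (∷≈ {N₁ = P₁} {P₂} τ≈σ M≈P) N≈N′ =
  subst (_ ≈M_) (sym (++-assoc P₁ (_ ∷ P₂) N′))
    (∷≈ τ≈σ (subst (_ ≈M_) (++-assoc P₁ P₂ N′) (++-cong-≈M M≈P N≈N′)))

++-comm-≈M : ∀ M N → (M ++ N) ≈M (N ++ M)
++-comm-≈M []      N = ≡⇒≈M (sym (++-identityʳ N))
++-comm-≈M (τ ∷ M) N = ∷≈ {N₁ = N} ≈T-refl (++-comm-≈M M N)

≈M-[]-inv : ∀ {N} → [] ≈M N → N ≡ []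
≈M-[]-inv []≈ = refl

≈M-singleton-inv : ∀ {τ N} → (τ ∷ []) ≈M N → ∃ λ σ → N ≡ σ ∷ [] × τ ≈T σ
≈M-singleton-inv (∷≈ {N₁ = N₁} {N₂} τ≈σ []≈N₁₂)
  with ++-conicalˡ N₁ N₂ (≈M-[]-inv []≈N₁₂) | ++-conicalʳ N₁ N₂ (≈M-[]-inv []≈N₁₂)
... | refl | refl = _ , refl , τ≈σ

multiset-commutativeMonoid : CommutativeMonoid 0ℓ 0ℓ
multiset-commutativeMonoid = record
  { Carrier             = MTy
  ; _≈_                 = _≈M_
  ; _∙_                 = _++_
  ; ε                   = []
  ; isCommutativeMonoid = record
    { isMonoid = record
      { isSemigroup = record
        { isMagma = record
          { isEquivalence = record { refl = ≈M-refl ; sym = ≈M-sym ; trans = ≈M-trans }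
          ; ∙-cong        = ++-cong-≈M
          }
        ; assoc = λ M N P → ≡⇒≈M (++-assoc M N P)
        }
      ; identity = (λ _ → ≈M-refl) , (λ M → ≡⇒≈M (++-identityʳ M))
      }
    ; comm = ++-comm-≈M
    }
  }

-- Typing contexts

infix 4 _≈C_
_≈C_ : ∀ {n} → Ctx n → Ctx n → Set
_≈C_ = Pointwise _≈M_

context-commutativeMonoid : ℕ → CommutativeMonoid 0ℓ 0ℓ
context-commutativeMonoid n = record
  { Carrier             = Ctx n
  ; _≈_                 = _≈C_
  ; _∙_                 = _+_
  ; ε                   = ∅
  ; isCommutativeMonoid = record
    { isMonoid = record
      { isSemigroup = record
        { isMagma = record
          { isEquivalence = Pointwise.isEquivalence M.isEquivalence n
          ; ∙-cong        = Pointwise.zipWith-cong M.∙-cong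
          }
        ; assoc = Pointwise.zipWith-assoc M.assoc
        }
      ; identity = Pointwise.zipWith-identityˡ M.identityˡ , Pointwise.zipWith-identityʳ M.identityʳ
      }
    ; comm = Pointwise.zipWith-comm M.comm
    }
  }
  where module M = CommutativeMonoid multiset-commutativeMonoid

module Ctx-Properties {n : ℕ} where
  open CommutativeMonoid (context-commutativeMonoid n) public
    using (setoid) renaming (refl to ≈C-refl; sym to ≈C-sym; trans to ≈C-trans; reflexive to ≡⇒≈C;
                             ∙-cong to +-cong; assoc to +-assoc; comm to +-comm;
                             identityˡ to +-identityˡ; identityʳ to +-identityʳ)
  open Algebra.Properties.CommutativeSemigroup
    (CommutativeMonoid.commutativeSemigroup (context-commutativeMonoid n)) public
    using (interchange; x∙yz≈y∙xz)

open Ctx-Properties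

module ≈C-Reasoning {n : ℕ} = Relation.Binary.Reasoning.Setoid (setoid {n})

put : ∀ {n} → Fin n → MTy → Ctx n
put x M = ∅ [ x ]≔ M

put-[] : ∀ {n} (x : Fin n) → put x [] ≡ ∅
put-[] zero    = refl
put-[] (suc x) = cong ([] ∷_) (put-[] x)

put-++ : ∀ {n} (x : Fin n) M N → put x (M ++ N) ≈C put x M + put x N
put-++ zero    M N = ≈M-refl ∷ ≈C-sym (+-identityˡ ∅)
put-++ (suc x) M N = []≈ ∷ put-++ x M N

put-cong : ∀ {n} (x : Fin n) {M N} → M ≈M N → put x M ≈C put x N
put-cong zero    M≈N = M≈N ∷ ≈C-refl
put-cong (suc x) M≈N = []≈ ∷ put-cong x M≈N

-- Weak-head redexes and weak-head normal forms

data HeadRedex {n : ℕ} : Tm n → Pos → Set where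
  root : ∀ {b u} → HeadRedex (app (lam b) u) []
  fun  : ∀ {t u r} → HeadRedex t r → HeadRedex (app t u) (d0 ∷ r)

HeadRedex⇒¬WHNF : ∀ {n} {t : Tm n} {r} → HeadRedex t r → ¬ WHNF t
HeadRedex⇒¬WHNF root    (wneu (napp ()))
HeadRedex⇒¬WHNF (fun h) (wneu (napp ne)) = HeadRedex⇒¬WHNF h (wneu ne)

HeadRedex⇒IsRedex : ∀ {n} {t : Tm n} {r} → HeadRedex t r → IsRedex t r
HeadRedex⇒IsRedex root          = tt
HeadRedex⇒IsRedex (fun root)    = tt
HeadRedex⇒IsRedex (fun (fun h)) = HeadRedex⇒IsRedex (fun h)

HeadRedex-contract : ∀ {n} {t : Tm n} {r} → HeadRedex t r → ∃ λ t′ → Step t r t′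
HeadRedex-contract root    = _ , β
HeadRedex-contract (fun h) with HeadRedex-contract h
... | _ , st = _ , appL st

HeadRedex-residual : ∀ {n} {t t′ : Tm n} {r p} → HeadRedex t r → Step t p t′ →
  p ≡ r ⊎ (Res t p r r × HeadRedex t′ r)
HeadRedex-residual root    β                = inj₁ refl
HeadRedex-residual root    (appL (lamS st)) = inj₂ (above , root)
HeadRedex-residual root    (appR st)        = inj₂ (above , root)
HeadRedex-residual (fun h) (appL st) with HeadRedex-residual h st
... | inj₁ refl       = inj₁ refl
... | inj₂ (res , h′) = inj₂ (app-l res , fun h′)
HeadRedex-residual (fun h) (appR st) = inj₂ (disj (λ ()) , fun h)

HeadRedex-used : ∀ {n} {t s : Tm n} {r} → HeadRedex t r → (ρ : t ↠ s) → WHNF s → Uses ρ r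
HeadRedex-used h done          w = ⊥-elim (HeadRedex⇒¬WHNF h w)
HeadRedex-used h (step p st ρ) w with HeadRedex-residual h st
... | inj₁ refl       = here
... | inj₂ (res , h′) = there res (HeadRedex-used h′ ρ w)

HeadRedex⇒WhNeeded : ∀ {n} {t : Tm n} {r} → HeadRedex t r → WhNeeded t r
HeadRedex⇒WhNeeded h = HeadRedex⇒IsRedex h , λ _ ρ → HeadRedex-used h ρ

WHNF-or-HeadRedex : ∀ {n} (t : Tm n) → WHNF t ⊎ ∃ (HeadRedex t)
WHNF-or-HeadRedex (var x) = inj₁ (wneu nvar)
WHNF-or-HeadRedex (lam t) = inj₁ wlam
WHNF-or-HeadRedex (app t u) with WHNF-or-HeadRedex t
... | inj₁ wlam      = inj₂ (_ , root)
... | inj₁ (wneu ne) = inj₁ (wneu (napp ne))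
... | inj₂ (_ , h)   = inj₂ (_ , fun h)

WHNF⇒WhndNormal : ∀ {n} {s : Tm n} → WHNF s → WhndNormal s
WHNF⇒WhndNormal w (_ , whnd p (_ , needed) _) with needed _ done w
... | ()

WhndNormal⇒WHNF : ∀ {n} {s : Tm n} → WhndNormal s → WHNF s
WhndNormal⇒WHNF {s = s} nf with WHNF-or-HeadRedex s
... | inj₁ w       = w
... | inj₂ (r , h) = ⊥-elim (nf (_ , whnd r (HeadRedex⇒WhNeeded h) (proj₂ (HeadRedex-contract h))))

Typable : ∀ {n} → Tm n → Set
Typable {n} t = Σ (Ctx n) λ Γ → Σ Ty λ τ → Γ ⊢ t ∶ τ

Neutral-typable : ∀ {n} {t : Tm n} → Neutral t → ∀ τ → ∃ λ Γ → Γ ⊢ t ∶ τ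
Neutral-typable nvar      τ = _ , ax
Neutral-typable (napp ne) τ with Neutral-typable ne ([] ⇒ τ)
... | _ , d = _ , →e d nil []≈

WHNF-typable : ∀ {n} {t : Tm n} → WHNF t → Typable t
WHNF-typable wlam      = ∅ , a , val
WHNF-typable (wneu ne) = _ , a , proj₂ (Neutral-typable ne a)

-- Axioms have size 0, so that substituting variables for variables costs nothing.
mutual
  size : ∀ {n} {Γ : Ctx n} {t τ} → Γ ⊢ t ∶ τ → ℕ
  size ax           = 0
  size val          = 0
  size (→i d)       = size d
  size (→e d as _)  = suc (size d ℕ.+ sizeArgs as)

  sizeArgs : ∀ {n} {Δ : Ctx n} {u N} → Args Δ u N → ℕ
  sizeArgs nil         = 0
  sizeArgs (cons d as) = size d ℕ.+ sizeArgs as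

-- Multisets are lists, so reduction and expansion preserve contexts and types only up to ≈.
infix 4 _⊢≈_∶_
record _⊢≈_∶_ {n : ℕ} (Γ : Ctx n) (t : Tm n) (τ : Ty) : Set where
  constructor deriv
  field
    {Γ′}       : Ctx n
    {τ′}       : Ty
    derivation : Γ′ ⊢ t ∶ τ′
    ctx≈       : Γ′ ≈C Γ
    ty≈        : τ′ ≈T τ

record Args≈ {n : ℕ} (Δ : Ctx n) (u : Tm n) (N : MTy) : Set where
  constructor args
  field
    {Δ′}        : Ctx n
    {N′}        : MTy
    derivations : Args Δ′ u N′
    ctx≈        : Δ′ ≈C Δ
    mty≈        : N′ ≈M N

open _⊢≈_∶_ using (derivation)
open Args≈ using (derivations)

-- Renaming

push : ∀ {m k} → (Fin m → Fin k) → Ctx m → Ctx k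
push ρ []      = ∅
push ρ (M ∷ Γ) = put (ρ zero) M + push (ρ ∘ suc) Γ

push-suc : ∀ {m k} (ρ : Fin m → Fin k) Γ → push (suc ∘ ρ) Γ ≡ [] ∷ push ρ Γ
push-suc ρ []      = refl
push-suc ρ (M ∷ Γ) = cong (put (suc (ρ zero)) M +_) (push-suc (ρ ∘ suc) Γ)

push-ext : ∀ {m k} (ρ : Fin m → Fin k) M Γ → push (ext ρ) (M ∷ Γ) ≈C M ∷ push ρ Γ
push-ext ρ M Γ = ≈C-trans (≡⇒≈C (cong (put zero M +_) (push-suc ρ Γ)))
                          (≡⇒≈M (++-identityʳ M) ∷ +-identityˡ (push ρ Γ))

push-id : ∀ {m} (Γ : Ctx m) → push id Γ ≈C Γ
push-id []      = ≈C-refl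
push-id (M ∷ Γ) = ≈C-trans (push-ext id M Γ) (≈M-refl ∷ push-id Γ)

push-weaken : ∀ {m} (Γ : Ctx m) → push suc Γ ≈C [] ∷ Γ
push-weaken Γ = ≈C-trans (≡⇒≈C (push-suc id Γ)) ([]≈ ∷ push-id Γ)

push-∅ : ∀ {m k} (ρ : Fin m → Fin k) → push ρ ∅ ≈C ∅
push-∅ {zero}  ρ = ≈C-refl
push-∅ {suc m} ρ = ≈C-trans (+-cong (≡⇒≈C (put-[] (ρ zero))) (push-∅ (ρ ∘ suc))) (+-identityˡ ∅)

push-single : ∀ {m k} (ρ : Fin m → Fin k) i τ → push ρ (single i τ) ≈C single (ρ i) τ
push-single ρ zero    τ = ≈C-trans (+-cong ≈C-refl (push-∅ (ρ ∘ suc))) (+-identityʳ _)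
push-single ρ (suc i) τ = ≈C-trans (+-cong (≡⇒≈C (put-[] (ρ zero))) (push-single (ρ ∘ suc) i τ))
                                   (+-identityˡ _)

push-+ : ∀ {m k} (ρ : Fin m → Fin k) (A B : Ctx m) → push ρ (A + B) ≈C push ρ A + push ρ B
push-+ ρ []      []      = ≈C-sym (+-identityˡ ∅)
push-+ ρ (M ∷ A) (N ∷ B) =
  ≈C-trans (+-cong (put-++ (ρ zero) M N) (push-+ (ρ ∘ suc) A B))
           (interchange (put (ρ zero) M) (put (ρ zero) N) _ _)

mutual
  ren-⊢ : ∀ {m k} (ρ : Fin m → Fin k) {Γ t τ} (d : Γ ⊢ t ∶ τ) →
    Σ (push ρ Γ ⊢≈ ren ρ t ∶ τ) λ d′ → size (derivation d′) ≡ size d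
  ren-⊢ ρ (ax {x = i}) = deriv ax (≈C-sym (push-single ρ i _)) ≈T-refl , refl
  ren-⊢ ρ val          = deriv val (≈C-sym (push-∅ ρ)) a≈ , refl
  ren-⊢ ρ (→i {Γ = Γ} {M = M} d) with ren-⊢ (ext ρ) d
  ... | deriv d′ Γ′≈ τ′≈ , eq with ≈C-trans Γ′≈ (push-ext ρ M Γ)
  ... | M′≈ ∷ Γ″≈ = deriv (→i d′) Γ″≈ (⇒≈ M′≈ τ′≈) , eq
  ren-⊢ ρ (→e {Γ = Γ} {Δ = Δ} d as M≈N) with ren-⊢ ρ d | ren-Args ρ as
  ... | deriv d′ Γ′≈ (⇒≈ M′≈ τ′≈) , eq | args as′ Δ′≈ N′≈ , eqs =
    deriv (→e d′ as′ (≈M-trans M′≈ (≈M-trans M≈N (≈M-sym N′≈))))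
          (≈C-trans (+-cong Γ′≈ Δ′≈) (≈C-sym (push-+ ρ Γ Δ))) τ′≈ ,
    cong suc (cong₂ ℕ._+_ eq eqs)

  ren-Args : ∀ {m k} (ρ : Fin m → Fin k) {Δ u N} (as : Args Δ u N) →
    Σ (Args≈ (push ρ Δ) (ren ρ u) N) λ as′ → sizeArgs (derivations as′) ≡ sizeArgs as
  ren-Args ρ nil = args nil (≈C-sym (push-∅ ρ)) []≈ , refl
  ren-Args ρ (cons {Δ = Δ} {Δs = Δs} d as) with ren-⊢ ρ d | ren-Args ρ as
  ... | deriv d′ Δ′≈ τ′≈ , eq | args as′ Δs′≈ N′≈ , eqs =
    args (cons d′ as′) (≈C-trans (+-cong Δ′≈ Δs′≈) (≈C-sym (push-+ ρ Δ Δs))) (∷-cong-≈M τ′≈ N′≈) ,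
    cong₂ ℕ._+_ eq eqs

mutual
  unren-⊢ : ∀ {m k} (ρ : Fin m → Fin k) (t : Tm m) {Γ τ} → Γ ⊢ ren ρ t ∶ τ →
    ∃₂ λ Γ₀ τ₀ → Γ₀ ⊢ t ∶ τ₀ × Γ ≈C push ρ Γ₀ × τ₀ ≈T τ
  unren-⊢ ρ (var i)   ax  = _ , _ , ax , ≈C-sym (push-single ρ i _) , ≈T-refl
  unren-⊢ ρ (lam t)   val = ∅ , a , val , ≈C-sym (push-∅ ρ) , a≈
  unren-⊢ ρ (lam t) (→i d) with unren-⊢ (ext ρ) t d
  ... | M₀ ∷ Γ₀ , τ₀ , d₀ , Γ≈ , τ₀≈ with ≈C-trans Γ≈ (push-ext ρ M₀ Γ₀)
  ... | M≈ ∷ Γ′≈ = Γ₀ , M₀ ⇒ τ₀ , →i d₀ , Γ′≈ , ⇒≈ (≈M-sym M≈) τ₀≈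
  unren-⊢ ρ (app t u) (→e d as M≈N) with unren-⊢ ρ t d | unren-Args ρ u as
  ... | Γ₀ , _ , d₀ , Γ≈ , ⇒≈ M₀≈ τ₀≈ | Δ₀ , N₀ , as₀ , Δ≈ , N₀≈ =
    Γ₀ + Δ₀ , _ , →e d₀ as₀ (≈M-trans M₀≈ (≈M-trans M≈N (≈M-sym N₀≈))) ,
    ≈C-trans (+-cong Γ≈ Δ≈) (≈C-sym (push-+ ρ Γ₀ Δ₀)) , τ₀≈

  unren-Args : ∀ {m k} (ρ : Fin m → Fin k) (u : Tm m) {Δ N} → Args Δ (ren ρ u) N →
    ∃₂ λ Δ₀ N₀ → Args Δ₀ u N₀ × Δ ≈C push ρ Δ₀ × N₀ ≈M N
  unren-Args ρ u nil = ∅ , [] , nil , ≈C-sym (push-∅ ρ) , []≈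
  unren-Args ρ u (cons d as) with unren-⊢ ρ u d | unren-Args ρ u as
  ... | Γ₀ , τ₀ , d₀ , Γ≈ , τ₀≈ | Δ₀ , N₀ , as₀ , Δ≈ , N₀≈ =
    Γ₀ + Δ₀ , τ₀ ∷ N₀ , cons d₀ as₀ , ≈C-trans (+-cong Γ≈ Δ≈) (≈C-sym (push-+ ρ Γ₀ Δ₀)) ,
    ∷-cong-≈M τ₀≈ N₀≈

-- Typed substitutions

infix 4 _⊢ˢ_∶_
data _⊢ˢ_∶_ {k : ℕ} : ∀ {m} → Ctx k → (Fin m → Tm k) → Ctx m → Set where
  []  : ∀ {Δ σ} → Δ ≈C ∅ → Δ ⊢ˢ σ ∶ []
  cons : ∀ {m Δ Δ₁ Δ₂} {σ : Fin (suc m) → Tm k} {M N Γ} →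
         Args Δ₁ (σ zero) N → M ≈M N → Δ₂ ⊢ˢ σ ∘ suc ∶ Γ → Δ ≈C Δ₁ + Δ₂ →
         Δ ⊢ˢ σ ∶ (M ∷ Γ)

sizeˢ : ∀ {m k} {Δ : Ctx k} {σ : Fin m → Tm k} {Γ} → Δ ⊢ˢ σ ∶ Γ → ℕ
sizeˢ ([] _)          = 0
sizeˢ (cons as _ S _) = sizeArgs as ℕ.+ sizeˢ S

⊢ˢ-cong : ∀ {m k} {Δ Δ′ : Ctx k} {σ : Fin m → Tm k} {Γ} → Δ ≈C Δ′ → Δ ⊢ˢ σ ∶ Γ → Δ′ ⊢ˢ σ ∶ Γ
⊢ˢ-cong Δ≈ ([] Δ≈∅)               = [] (≈C-trans (≈C-sym Δ≈) Δ≈∅)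
⊢ˢ-cong Δ≈ (cons as M≈N S Δ≈Δ₁₂) = cons as M≈N S (≈C-trans (≈C-sym Δ≈) Δ≈Δ₁₂)

⊢ˢ-∅ : ∀ {m k} (σ : Fin m → Tm k) → ∅ ⊢ˢ σ ∶ ∅
⊢ˢ-∅ {zero}  σ = [] ≈C-refl
⊢ˢ-∅ {suc m} σ = cons nil []≈ (⊢ˢ-∅ (σ ∘ suc)) (≈C-sym (+-identityˡ ∅))

⊢ˢ-∅-inv : ∀ {m k} {Δ : Ctx k} {σ : Fin m → Tm k} → Δ ⊢ˢ σ ∶ ∅ → Δ ≈C ∅
⊢ˢ-∅-inv ([] Δ≈∅)                = Δ≈∅
⊢ˢ-∅-inv (cons nil []≈ S Δ≈∅+Δ₂) = ≈C-trans Δ≈∅+Δ₂ (≈C-trans (+-identityˡ _) (⊢ˢ-∅-inv S))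

⊢ˢ-single : ∀ {m k} {Δ : Ctx k} {σ : Fin m → Tm k} i {τ} → Δ ⊢ σ i ∶ τ → Δ ⊢ˢ σ ∶ single i τ
⊢ˢ-single zero    d =
  cons (cons d nil) ≈M-refl (⊢ˢ-∅ _) (≈C-sym (≈C-trans (+-identityʳ _) (+-identityʳ _)))
⊢ˢ-single (suc i) d = cons nil []≈ (⊢ˢ-single i d) (≈C-sym (+-identityˡ _))

⊢ˢ-single-inv : ∀ {m k} {Δ : Ctx k} {σ : Fin m → Tm k} i {τ} (S : Δ ⊢ˢ σ ∶ single i τ) →
  Σ (Δ ⊢≈ σ i ∶ τ) λ d → size (derivation d) ≤ sizeˢ S
⊢ˢ-single-inv zero (cons as M≈N S Δ≈) with ≈M-singleton-inv M≈N
⊢ˢ-single-inv zero (cons (cons d nil) _ S Δ≈) | _ , refl , τ≈σ =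
  deriv d (≈C-sym (≈C-trans Δ≈ (≈C-trans (+-cong (+-identityʳ _) (⊢ˢ-∅-inv S)) (+-identityʳ _))))
          (≈T-sym τ≈σ) ,
  ≤-trans (m≤m+n (size d) 0) (m≤m+n _ (sizeˢ S))
⊢ˢ-single-inv (suc i) (cons nil []≈ S Δ≈) with ⊢ˢ-single-inv i S
... | deriv d Γ≈ τ≈ , le = deriv d (≈C-trans Γ≈ (≈C-sym (≈C-trans Δ≈ (+-identityˡ _)))) τ≈ , le

var-Args : ∀ {k} (x : Fin k) M → Σ (Args≈ (put x M) (var x) M) λ as → sizeArgs (derivations as) ≡ 0
var-Args x []      = args nil (≡⇒≈C (sym (put-[] x))) []≈ , refl
var-Args x (τ ∷ M) with var-Args x M
... | args as Δ≈ M′≈ , eq =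
  args (cons ax as) (≈C-trans (+-cong ≈C-refl Δ≈) (≈C-sym (put-++ x (τ ∷ []) M))) (∷-cong-≈M ≈T-refl M′≈) ,
  eq

var-Args-inv : ∀ {k} {x : Fin k} {Δ N} → Args Δ (var x) N → Δ ≈C put x N
var-Args-inv {x = x} nil = ≡⇒≈C (sym (put-[] x))
var-Args-inv {x = x} (cons {σ = τ} {N = N} ax as) =
  ≈C-trans (+-cong ≈C-refl (var-Args-inv as)) (≈C-sym (put-++ x (τ ∷ []) N))

⊢ˢ-var : ∀ {m k} (ρ : Fin m → Fin k) Γ → Σ (push ρ Γ ⊢ˢ var ∘ ρ ∶ Γ) λ S → sizeˢ S ≡ 0
⊢ˢ-var ρ []      = [] ≈C-refl , refl
⊢ˢ-var ρ (M ∷ Γ) with var-Args (ρ zero) M | ⊢ˢ-var (ρ ∘ suc) Γ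
... | args as Δ≈ M′≈ , eq | S , eqˢ =
  cons as (≈M-sym M′≈) S (+-cong (≈C-sym Δ≈) ≈C-refl) , cong₂ ℕ._+_ eq eqˢ

⊢ˢ-var-inv : ∀ {m k} {Δ : Ctx k} (ρ : Fin m → Fin k) {Γ} → Δ ⊢ˢ var ∘ ρ ∶ Γ → Δ ≈C push ρ Γ
⊢ˢ-var-inv ρ ([] Δ≈∅)           = Δ≈∅
⊢ˢ-var-inv ρ (cons as M≈N S Δ≈) =
  ≈C-trans Δ≈ (+-cong (≈C-trans (var-Args-inv as) (put-cong (ρ zero) (≈M-sym M≈N)))
                      (⊢ˢ-var-inv (ρ ∘ suc) S))

Args-select : ∀ {k} P₁ {σ P₂} {Δ : Ctx k} {u} (as : Args Δ u (P₁ ++ σ ∷ P₂)) →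
  ∃₂ λ Δ₁ Δ₂ → Σ (Δ₁ ⊢ u ∶ σ) λ d → Σ (Args Δ₂ u (P₁ ++ P₂)) λ as′ →
    Δ ≈C Δ₁ + Δ₂ × size d ℕ.+ sizeArgs as′ ≡ sizeArgs as
Args-select []       (cons d as) = _ , _ , d , as , ≈C-refl , refl
Args-select (_ ∷ P₁) (cons {Δ = Δ} d′ as) with Args-select P₁ as
... | Δ₁ , Δ₂ , d , as′ , Δs≈ , eq =
  Δ₁ , Δ + Δ₂ , d , cons d′ as′ , ≈C-trans (+-cong ≈C-refl Δs≈) (x∙yz≈y∙xz Δ Δ₁ Δ₂) ,
  trans (ℕ-CS.x∙yz≈y∙xz (size d) (size d′) (sizeArgs as′)) (cong (size d′ ℕ.+_) eq)

Args-split : ∀ {k} M M′ {N} {Δ : Ctx k} {u} → (M ++ M′) ≈M N → (as : Args Δ u N) →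
  ∃₂ λ N₁ N₂ → ∃₂ λ Δ₁ Δ₂ → Σ (Args Δ₁ u N₁) λ as₁ → Σ (Args Δ₂ u N₂) λ as₂ →
    M ≈M N₁ × M′ ≈M N₂ × Δ ≈C Δ₁ + Δ₂ × sizeArgs as₁ ℕ.+ sizeArgs as₂ ≡ sizeArgs as
Args-split []      M′ M′≈N as =
  [] , _ , ∅ , _ , nil , as , []≈ , M′≈N , ≈C-sym (+-identityˡ _) , refl
Args-split (τ ∷ M) M′ (∷≈ {N₁ = P₁} τ≈σ M≈P) as with Args-select P₁ as
... | Δ₀ , Δ′ , d , as′ , Δ≈ , eq with Args-split M M′ M≈P as′
... | N₁ , N₂ , Δ₁ , Δ₂ , as₁ , as₂ , M≈N₁ , M′≈N₂ , Δ′≈ , eq′ =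
  _ ∷ N₁ , N₂ , Δ₀ + Δ₁ , Δ₂ , cons d as₁ , as₂ , ∷-cong-≈M τ≈σ M≈N₁ , M′≈N₂ ,
  ≈C-trans Δ≈ (≈C-trans (+-cong ≈C-refl Δ′≈) (≈C-sym (+-assoc Δ₀ Δ₁ Δ₂))) ,
  trans (ℕP.+-assoc (size d) (sizeArgs as₁) (sizeArgs as₂)) (trans (cong (size d ℕ.+_) eq′) eq)

⊢ˢ-split : ∀ {m k} {Δ : Ctx k} {σ : Fin m → Tm k} (A B : Ctx m) (S : Δ ⊢ˢ σ ∶ A + B) →
  ∃₂ λ Δ₁ Δ₂ → Σ (Δ₁ ⊢ˢ σ ∶ A) λ S₁ → Σ (Δ₂ ⊢ˢ σ ∶ B) λ S₂ →
    Δ ≈C Δ₁ + Δ₂ × sizeˢ S₁ ℕ.+ sizeˢ S₂ ≡ sizeˢ S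
⊢ˢ-split [] [] ([] Δ≈∅) =
  ∅ , ∅ , [] ≈C-refl , [] ≈C-refl , ≈C-trans Δ≈∅ (≈C-sym (+-identityˡ ∅)) , refl
⊢ˢ-split (M ∷ A) (M′ ∷ B) (cons as M≈N S Δ≈) with Args-split M M′ M≈N as | ⊢ˢ-split A B S
... | N₁ , N₂ , E₁ , E₂ , as₁ , as₂ , M≈N₁ , M′≈N₂ , E≈ , eq | D₁ , D₂ , S₁ , S₂ , D≈ , eqˢ =
  E₁ + D₁ , E₂ + D₂ , cons as₁ M≈N₁ S₁ ≈C-refl , cons as₂ M′≈N₂ S₂ ≈C-refl ,
  ≈C-trans Δ≈ (≈C-trans (+-cong E≈ D≈) (interchange E₁ E₂ D₁ D₂)) ,
  trans (ℕ-CS.interchange (sizeArgs as₁) (sizeˢ S₁) (sizeArgs as₂) (sizeˢ S₂)) (cong₂ ℕ._+_ eq eqˢ)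

Args-++ : ∀ {k} {Δ₁ Δ₂ : Ctx k} {u N₁ N₂} →
  Args Δ₁ u N₁ → Args Δ₂ u N₂ → Args (Δ₁ + Δ₂) u (N₁ ++ N₂)
Args-++ {Δ₂ = Δ₂} {u} {N₂ = N₂} nil as₂ =
  subst (λ Δ → Args Δ u N₂) (sym (Vecₚ.zipWith-identityˡ (λ _ → refl) Δ₂)) as₂
Args-++ {Δ₂ = Δ₂} {u} (cons {Δ = Δ} {Δs} d as₁) as₂ =
  subst (λ Δ′ → Args Δ′ u _) (sym (Vecₚ.zipWith-assoc ++-assoc Δ Δs Δ₂)) (cons d (Args-++ as₁ as₂))

⊢ˢ-merge : ∀ {m k} {Δ₁ Δ₂ : Ctx k} {σ : Fin m → Tm k} {A B} →
  Δ₁ ⊢ˢ σ ∶ A → Δ₂ ⊢ˢ σ ∶ B → (Δ₁ + Δ₂) ⊢ˢ σ ∶ (A + B)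
⊢ˢ-merge ([] Δ₁≈∅) ([] Δ₂≈∅) = [] (≈C-trans (+-cong Δ₁≈∅ Δ₂≈∅) (+-identityˡ ∅))
⊢ˢ-merge (cons {Δ₁ = E₁} {D₁} as₁ M≈N₁ S₁ Δ₁≈) (cons {Δ₁ = E₂} {D₂} as₂ M′≈N₂ S₂ Δ₂≈) =
  cons (Args-++ as₁ as₂) (++-cong-≈M M≈N₁ M′≈N₂) (⊢ˢ-merge S₁ S₂)
       (≈C-trans (+-cong Δ₁≈ Δ₂≈) (interchange E₁ D₁ E₂ D₂))

⊢ˢ-weaken : ∀ {m k} {Δ : Ctx k} {σ : Fin m → Tm k} {Γ} (S : Δ ⊢ˢ σ ∶ Γ) →
  Σ ([] ∷ Δ ⊢ˢ ren suc ∘ σ ∶ Γ) λ S′ → sizeˢ S′ ≡ sizeˢ S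
⊢ˢ-weaken ([] Δ≈∅) = [] ([]≈ ∷ Δ≈∅) , refl
⊢ˢ-weaken (cons as M≈N S Δ≈) with ren-Args suc as | ⊢ˢ-weaken S
... | args as′ Δ′≈ N′≈ , eq | S′ , eqˢ =
  cons as′ (≈M-trans M≈N (≈M-sym N′≈)) S′
       (≈C-trans ([]≈ ∷ Δ≈) (+-cong (≈C-sym (≈C-trans Δ′≈ (push-weaken _))) ≈C-refl)) ,
  cong₂ ℕ._+_ eq eqˢ

⊢ˢ-exts : ∀ {m k} {Δ : Ctx k} {σ : Fin m → Tm k} {Γ} M (S : Δ ⊢ˢ σ ∶ Γ) →
  Σ (M ∷ Δ ⊢ˢ exts σ ∶ M ∷ Γ) λ S′ → sizeˢ S′ ≡ sizeˢ S
⊢ˢ-exts {Δ = Δ} M S with var-Args zero M | ⊢ˢ-weaken S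
... | args as Δ′≈ M′≈ , eq | S′ , eqˢ =
  cons as (≈M-sym M′≈) S′
       (≈C-sym (≈C-trans (+-cong Δ′≈ ≈C-refl) (≡⇒≈M (++-identityʳ M) ∷ +-identityˡ Δ))) ,
  cong₂ ℕ._+_ eq eqˢ

⊢ˢ-unweaken : ∀ {m k} {Δ : Ctx (suc k)} {σ : Fin m → Tm k} {Γ} → Δ ⊢ˢ ren suc ∘ σ ∶ Γ →
  ∃ λ Δ′ → Δ′ ⊢ˢ σ ∶ Γ × Δ ≈C [] ∷ Δ′
⊢ˢ-unweaken ([] (Δ≈∅ ∷ Δs≈∅)) = _ , [] Δs≈∅ , Δ≈∅ ∷ ≈C-refl
⊢ˢ-unweaken {σ = σ} (cons as M≈N S Δ≈) with unren-Args suc (σ zero) as | ⊢ˢ-unweaken S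
... | Δ₀ , N₀ , as₀ , Δ₀≈ , N₀≈ | Δ′ , S′ , Δs≈ =
  Δ₀ + Δ′ , cons as₀ (≈M-trans M≈N (≈M-sym N₀≈)) S′ ≈C-refl ,
  ≈C-trans Δ≈ (+-cong (≈C-trans Δ₀≈ (push-weaken Δ₀)) Δs≈)

⊢ˢ-exts-inv : ∀ {m k} {Δ : Ctx (suc k)} {σ : Fin m → Tm k} {M Γ} → Δ ⊢ˢ exts σ ∶ M ∷ Γ →
  ∃₂ λ N Δ′ → M ≈M N × Δ′ ⊢ˢ σ ∶ Γ × Δ ≈C N ∷ Δ′
⊢ˢ-exts-inv (cons {N = N} as M≈N S Δ≈) with ⊢ˢ-unweaken S
... | Δ′ , S′ , Δs≈ =
  N , Δ′ , M≈N , S′ ,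
  ≈C-trans Δ≈ (≈C-trans (+-cong (var-Args-inv as) Δs≈) (≡⇒≈M (++-identityʳ N) ∷ +-identityˡ Δ′))

-- Substitution and anti-substitution

+-mono-≤-+ : ∀ {i i′ k k′ l} j j′ → i ≤ j ℕ.+ k → i′ ≤ j′ ℕ.+ k′ → k ℕ.+ k′ ≡ l →
  i ℕ.+ i′ ≤ (j ℕ.+ j′) ℕ.+ l
+-mono-≤-+ {i} {i′} {k} {k′} j j′ p q refl =
  subst (i ℕ.+ i′ ≤_) (ℕ-CS.interchange j k j′ k′) (ℕP.+-mono-≤ p q)

mutual
  sub-⊢ : ∀ {m k} {Γ : Ctx m} {Δ : Ctx k} {σ t τ} (d : Γ ⊢ t ∶ τ) (S : Δ ⊢ˢ σ ∶ Γ) →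
    Σ (Δ ⊢≈ sub σ t ∶ τ) λ d′ → size (derivation d′) ≤ size d ℕ.+ sizeˢ S
  sub-⊢ (ax {x = i}) S = ⊢ˢ-single-inv i S
  sub-⊢ val          S = deriv val (≈C-sym (⊢ˢ-∅-inv S)) a≈ , z≤n
  sub-⊢ (→i {M = M} d) S with ⊢ˢ-exts M S
  ... | S′ , eq with sub-⊢ d S′
  ... | deriv d′ (M′≈ ∷ Γ′≈) τ′≈ , le =
    deriv (→i d′) Γ′≈ (⇒≈ M′≈ τ′≈) , subst (λ s → size d′ ≤ size d ℕ.+ s) eq le
  sub-⊢ (→e {Γ = Γ} {Δ = Δ} d as M≈N) S with ⊢ˢ-split Γ Δ S
  ... | Δ₁ , Δ₂ , S₁ , S₂ , Δ≈ , eq with sub-⊢ d S₁ | sub-Args as S₂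
  ... | deriv d′ Γ′≈ (⇒≈ M′≈ τ′≈) , le | args as′ Δ′≈ N′≈ , leₐ =
    deriv (→e d′ as′ (≈M-trans M′≈ (≈M-trans M≈N (≈M-sym N′≈))))
          (≈C-trans (+-cong Γ′≈ Δ′≈) (≈C-sym Δ≈)) τ′≈ ,
    s≤s (+-mono-≤-+ (size d) (sizeArgs as) le leₐ eq)

  sub-Args : ∀ {m k} {Γ : Ctx m} {Δ : Ctx k} {σ u N} (as : Args Γ u N) (S : Δ ⊢ˢ σ ∶ Γ) →
    Σ (Args≈ Δ (sub σ u) N) λ as′ → sizeArgs (derivations as′) ≤ sizeArgs as ℕ.+ sizeˢ S
  sub-Args nil S = args nil (≈C-sym (⊢ˢ-∅-inv S)) []≈ , z≤n
  sub-Args (cons {Δ = Γ} {Δs = Γs} d as) S with ⊢ˢ-split Γ Γs S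
  ... | Δ₁ , Δ₂ , S₁ , S₂ , Δ≈ , eq with sub-⊢ d S₁ | sub-Args as S₂
  ... | deriv d′ Γ′≈ τ′≈ , le | args as′ Δ′≈ N′≈ , leₐ =
    args (cons d′ as′) (≈C-trans (+-cong Γ′≈ Δ′≈) (≈C-sym Δ≈)) (∷-cong-≈M τ′≈ N′≈) ,
    +-mono-≤-+ (size d) (sizeArgs as) le leₐ eq

mutual
  unsub-⊢ : ∀ {m k} {Δ : Ctx k} {σ : Fin m → Tm k} (t : Tm m) {τ} → Δ ⊢ sub σ t ∶ τ →
    ∃₂ λ Γ τ₀ → Γ ⊢ t ∶ τ₀ × Δ ⊢ˢ σ ∶ Γ × τ₀ ≈T τ
  unsub-⊢ (var i) d = _ , _ , ax , ⊢ˢ-single i d , ≈T-refl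
  unsub-⊢ (app t u) (→e d as M≈N) with unsub-⊢ t d | unsub-Args u as
  ... | Γ , _ , d₀ , S₁ , ⇒≈ M₀≈ τ₀≈ | Γs , N₀ , as₀ , S₂ , N₀≈ =
    Γ + Γs , _ , →e d₀ as₀ (≈M-trans M₀≈ (≈M-trans M≈N (≈M-sym N₀≈))) , ⊢ˢ-merge S₁ S₂ , τ₀≈
  unsub-⊢ (lam t) val = ∅ , a , val , ⊢ˢ-∅ _ , a≈
  unsub-⊢ (lam t) (→i d) with unsub-⊢ t d
  ... | M₀ ∷ Γ , τ₀ , d₀ , S , τ₀≈ with ⊢ˢ-exts-inv S
  ... | N , Δ′ , M₀≈N , S′ , N≈ ∷ Δ′≈ =
    Γ , M₀ ⇒ τ₀ , →i d₀ , ⊢ˢ-cong (≈C-sym Δ′≈) S′ , ⇒≈ (≈M-trans M₀≈N (≈M-sym N≈)) τ₀≈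

  unsub-Args : ∀ {m k} {Δ : Ctx k} {σ : Fin m → Tm k} (u : Tm m) {N} → Args Δ (sub σ u) N →
    ∃₂ λ Γ N₀ → Args Γ u N₀ × Δ ⊢ˢ σ ∶ Γ × N₀ ≈M N
  unsub-Args u nil = ∅ , [] , nil , ⊢ˢ-∅ _ , []≈
  unsub-Args u (cons d as) with unsub-⊢ u d | unsub-Args u as
  ... | Γ , τ₀ , d₀ , S₁ , τ₀≈ | Γs , N₀ , as₀ , S₂ , N₀≈ =
    Γ + Γs , τ₀ ∷ N₀ , cons d₀ as₀ , ⊢ˢ-merge S₁ S₂ , ∷-cong-≈M τ₀≈ N₀≈

-- Subject expansion and head subject reduction

mutual
  ⊢-expand : ∀ {n} {t t′ : Tm n} {p} → Step t p t′ → ∀ {Γ τ} → Γ ⊢ t′ ∶ τ → Γ ⊢≈ t ∶ τ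
  ⊢-expand (β {b = b}) {Γ} d with unsub-⊢ b d
  ... | M ∷ Γ₀ , τ₀ , d₀ , cons {Δ₁ = Δ₁} {Δ₂} as M≈N S Γ≈ , τ₀≈ =
    deriv (→e (→i d₀) as M≈N) Γ₀+Δ₁≈Γ τ₀≈
    where
    open ≈C-Reasoning
    Γ₀+Δ₁≈Γ : Γ₀ + Δ₁ ≈C Γ
    Γ₀+Δ₁≈Γ = begin
      Γ₀ + Δ₁         ≈⟨ +-comm Γ₀ Δ₁ ⟩
      Δ₁ + Γ₀         ≈⟨ +-cong ≈C-refl (push-id Γ₀) ⟨
      Δ₁ + push id Γ₀ ≈⟨ +-cong ≈C-refl (⊢ˢ-var-inv id S) ⟨
      Δ₁ + Δ₂         ≈⟨ Γ≈ ⟨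
      Γ               ∎
  ⊢-expand (appL st) (→e d as M≈N) with ⊢-expand st d
  ... | deriv d′ Γ′≈ (⇒≈ M′≈ τ′≈) = deriv (→e d′ as (≈M-trans M′≈ M≈N)) (+-cong Γ′≈ ≈C-refl) τ′≈
  ⊢-expand (appR st) (→e d as M≈N) with Args-expand st as
  ... | args as′ Δ′≈ N′≈ = deriv (→e d as′ (≈M-trans M≈N (≈M-sym N′≈))) (+-cong ≈C-refl Δ′≈) ≈T-refl
  ⊢-expand (lamS st) val    = deriv val ≈C-refl a≈
  ⊢-expand (lamS st) (→i d) with ⊢-expand st d
  ... | deriv d′ (M′≈ ∷ Γ′≈) τ′≈ = deriv (→i d′) Γ′≈ (⇒≈ M′≈ τ′≈)

  Args-expand : ∀ {n} {u u′ : Tm n} {p} → Step u p u′ → ∀ {Δ N} → Args Δ u′ N → Args≈ Δ u N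
  Args-expand st nil = args nil ≈C-refl []≈
  Args-expand st (cons d as) with ⊢-expand st d | Args-expand st as
  ... | deriv d′ Γ′≈ τ′≈ | args as′ Δ′≈ N′≈ =
    args (cons d′ as′) (+-cong Γ′≈ Δ′≈) (∷-cong-≈M τ′≈ N′≈)

Typable-expand* : ∀ {n} {t s : Tm n} → t →whnd* s → Typable s → Typable t
Typable-expand* refl*                      ty = ty
Typable-expand* (step* (whnd _ _ st) steps) ty with Typable-expand* steps ty
... | _ , _ , d = _ , _ , derivation (⊢-expand st d)

head-subject-reduction : ∀ {n} {t t′ : Tm n} {r} → HeadRedex t r → Step t r t′ →
  ∀ {Γ τ} (d : Γ ⊢ t ∶ τ) → Σ (Γ ⊢≈ t′ ∶ τ) λ d′ → size (derivation d′) < size d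
head-subject-reduction root β (→e {Γ = Γ} {Δ = Δ} (→i d) as M≈N) with ⊢ˢ-var id Γ
... | S , eq with sub-⊢ d (cons as M≈N S ≈C-refl)
... | deriv d′ Δ′≈ τ′≈ , le =
  deriv d′ (≈C-trans Δ′≈ (≈C-trans (+-cong ≈C-refl (push-id Γ)) (+-comm Δ Γ))) τ′≈ , s≤s size-d′≤
  where
  open ℕP.≤-Reasoning
  size-d′≤ : size d′ ≤ size d ℕ.+ sizeArgs as
  size-d′≤ = begin
    size d′                                ≤⟨ le ⟩
    size d ℕ.+ (sizeArgs as ℕ.+ sizeˢ S)   ≡⟨ cong (λ s → size d ℕ.+ (sizeArgs as ℕ.+ s)) eq ⟩
    size d ℕ.+ (sizeArgs as ℕ.+ 0)         ≡⟨ cong (size d ℕ.+_) (ℕP.+-identityʳ (sizeArgs as)) ⟩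
    size d ℕ.+ sizeArgs as                 ∎
head-subject-reduction (fun h) (appL st) (→e d as M≈N) with head-subject-reduction h st d
... | deriv d′ Γ′≈ (⇒≈ M′≈ τ′≈) , lt =
  deriv (→e d′ as (≈M-trans M′≈ M≈N)) (+-cong Γ′≈ ≈C-refl) τ′≈ , s≤s (ℕP.+-monoˡ-< (sizeArgs as) lt)

Typable⇒WhndNormalising : ∀ {n} {Γ : Ctx n} {t τ} (d : Γ ⊢ t ∶ τ) →
  Acc _<_ (size d) → WhndNormalising t
Typable⇒WhndNormalising {t = t} d (acc smaller) with WHNF-or-HeadRedex t
... | inj₁ w = t , refl* , WHNF⇒WhndNormal w
... | inj₂ (r , h) with HeadRedex-contract h
... | t′ , st with head-subject-reduction h st d
... | deriv d′ _ _ , lt with Typable⇒WhndNormalising d′ (smaller lt)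
... | s , steps , nf = s , step* (whnd r (HeadRedex⇒WhNeeded h) st) steps , nf

mainTheorem2 : (n : ℕ) (t : Tm n) →
    (Σ (Ctx n) λ Γ → Σ Ty λ τ → Γ ⊢ t ∶ τ) ⇔ WhndNormalising t
mainTheorem2 n t = mk⇔
  (λ (_ , _ , d) → Typable⇒WhndNormalising d (<-wellFounded (size d)))
  (λ (_ , steps , nf) → Typable-expand* steps (WHNF-typable (WhndNormal⇒WHNF nf)))
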